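{- Assume one of the following four settings: (i) $\mathfrak{D}'=\mathfrak{D}$ and $R\in\mathfrak{D}$; (ii) $\mathfrak{T}_a\subseteq\mathfrak{D}'\subseteq\mathfrak{D}$ and $R\in\mathfrak{T}_a$; (iii) $\mathfrak{D}'=\mathfrak{P}$ and $R\in\mathfrak{P}$; (iv) $\mathfrak{D}'=\mathfrak{P}^*$ and $R\in\mathfrak{P}^*$. Let $S\in\mathfrak{D}$, and let $\rho$ be an S-scheme from $R$ to $S$ with respect to $\mathfrak{D}'$ such that, for all $G,H\in\mathfrak{D}'$, $\xi\in\mathcal{S}(G,R)$, $\zeta\in\mathcal{S}(H,R)$, $v\in V(G)$, $w\in V(H)$, $$\alpha^R_{G,\xi}(v)=\alpha^R_{H,\zeta}(w)\Rightarrow\alpha^S_{G,\rho_G(\xi)}(v)=\alpha^S_{H,\rho_H(\zeta)}(w).$$ Put $\epsilon:=\alpha^S_{\mathcal{E}(R),\rho_{\mathcal{E}(R)}(\phi_R)}$. Let $\mathfrak{a}\in\mathcal{E}_o(R)$ and $\pi\in\mathrm{Aut}(X(\mathfrak{a}))$, and write $\rho$ for $\rho_{X(\mathfrak{a})}$. Then: - $\rho(\iota(\mathfrak{a})\circ\pi)(v)=\rho(\iota(\mathfrak{a}))(\pi(v))$ for all $v\in V(X(\mathfrak{a}))$; - $\rho(\iota(\mathfrak{a})\circ\pi)(p)=\epsilon(\mathfrak{a})_1$; - $\rho(\iota(\mathfrak{a})\circ\pi)[D]=\epsilon(\mathfrak{a})_2$; - $\rho(\iota(\mathfrak{a})\c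irc\pi)[U]=\epsilon(\mathfrak{a})_3$.
   Context: Digraphs $G=(V(G),A(G))$ have a finite nonempty vertex set, and $A(G)\subseteq V(G)\times V(G)$; loops are allowed. $G^*$ is $G$ with loops removed. $N^{in}_G(v)=\{w\ne v:wv\in A(G)\}$ and $N^{out}_G(v)=\{w\ne v:vw\in A(G)\}$. A homomorphism maps arcs to arcs; it is strict if, in addition, it maps proper arcs to proper arcs. $\mathcal{S}(G,H)$ is the set of strict homomorphisms. Classes of digraphs: - $\mathfrak{D}$ is a representative system of the isomorphism classes of finite digraphs; constructed digraphs are identified with their representatives. - $\mathfrak{T}_a=\{G\in\mathfrak{D}:G^*\text{ has no closed walk}\}$. - $\mathfrak{P}$ is the set of posets in $\mathfrak{D}$, and $\mathfrak{P}^*=\{P^*:P\in\mathfrak{P}\}$. An S-scheme from $R$ to $S$ with respect to $\mathfrak{D}'$ is a family of maps $\rho_G:\mathcal{S}(G,R)\to\mathcal{S}(G,S)$, $G\in\mathfrak{D}'$. EV-system of $T\in\{R,S\}$ with respect to $\mathfrak{D}'$: - Vertex set $\mathcal{E}_o(T)=\{(v,D,U): v\in V(T),\ D\subseteq N^{in}_T(v),\ U\subseteq N^{out}_T(v)\}$, with components $\mathfrak{a}_1,\mathfrak{a}_2,\mathfrak{a}_3$. - $\phi_T(\mathfrak{a})=\mathfrak{a}_1$. - $\alpha^T_{G,\xi}(v)=(\xi(v),\xi[N^{in}_G(v)],\xi[N^{out}_G(v)])$. - $\mathfrak{a}\mathfrak{b}$ is an arc iff $\mathfrak{a}=\alpha^T_{G,\xi}(v)$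 and $\mathfrak{b}=\alpha^T_{G,\xi}(w)$ for some $G\in\mathfrak{D}'$, $\xi\in\mathcal{S}(G,T)$ and $vw\in A(G)$. In each setting $\mathcal{E}(R)\in\mathfrak{D}'$ and $\phi_R\in\mathcal{S}(\mathcal{E}(R),R)$. $X^m_n$ has vertex set $D\cup\{p\}\cup U$ (disjoint, $\#D=m$, $\#U=n$) and arcs $(D\times\{p\})\cup(\{p\}\times U)$. For $\mathfrak{a}\in\mathcal{E}_o(R)$, the digraph $X(\mathfrak{a})$ is: - $X^{\#\mathfrak{a}_2}_{\#\mathfrak{a}_3}$ in settings (i) and (ii); - its transitive hull with all loops added in setting (iii); - its transitive hull in setting (iv). $\iota(\mathfrak{a})$ is a fixed map $V(X(\mathfrak{a}))\to V(R)$ sending $p$ to $\mathfrak{a}_1$, $D$ bijectively onto $\mathfrak{a}_2$, and $U$ bijectively onto $\mathfrak{a}_3$. It is a strict homomorphism, and $X(\mathfrak{a})\in\mathfrak{D}'$. -}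

module Defs where

open import Level using () renaming (suc to lsuc; zero to lzero)
open import Data.Nat using (ℕ)
open import Data.Fin using (Fin; _≟_)
open import Data.Fin.Subset using (Subset; ∣_∣) renaming (_∈_ to _∈ₛ_)
open import Data.Vec using (lookup)
open import Data.Bool using (Bool; true; false; T; not; _∧_; _∨_)
open import Data.List using (List; []; _∷_; allFin)
open import Data.List.Membership.Propositional using (_∈_)
open import Data.Product using (Σ; ∃; _×_; _,_; proj₁; proj₂)
open import Data.Sum using (_⊎_; inj₁; inj₂)
open import Data.Unit using (⊤; tt)
open import Relation.Nullary using (¬_; does)
open import Relation.Binary.PropositionalEquality using (_≡_; _≢_; refl; cong; trans; sym)
open import Relation.Binary.Construct.Closure.Transitive using (TransClosure)
open import Function.Bundles using (_↔_; _⇔_; Inverse; Equivalence)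

-- Digraphs (loops allowed).  The arc relation is a relation on the
-- vertex set (an arc vw exists iff  Arc v w  is inhabited).

record Digraph : Set₁ where
  field
    V   : Set
    Arc : V → V → Set
open Digraph public

Finite : Digraph → Set
Finite G = Σ (List (V G)) λ xs → ∀ v → v ∈ xs

record FinGraph : Set where
  field
    size : ℕ
    arc  : Fin size → Fin size → Bool
open FinGraph public

⟦_⟧ : FinGraph → Digraph
⟦ R ⟧ = record { V = Fin (size R) ; Arc = λ x y → T (arc R x y) }

ProperArc : (G : Digraph) → V G → V G → Set
ProperArc G x y = x ≢ y × Arc G x y

NoClosedWalk* : Digraph → Set
NoClosedWalk* G = ∀ x → ¬ TransClosure (ProperArc G) x x

IsPoset : Digraph → Set
IsPoset G = (∀ x → Arc G x x)
          × (∀ x y → Arc G x y → Arc G y x → x ≡ y)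
          × (∀ x y z → Arc G x y → Arc G y z → Arc G x z)

-- P* for a poset P : irreflexive and transitive (antisymmetry follows)
IsStrictPoset : Digraph → Set
IsStrictPoset G = (∀ x → ¬ Arc G x x)
                × (∀ x y z → Arc G x y → Arc G y z → Arc G x z)

Iso : Digraph → Digraph → Set
Iso G H = Σ (V G ↔ V H) λ f → ∀ x y → Arc G x y ⇔ Arc H (Inverse.to f x) (Inverse.to f y)

Aut : Digraph → Set
Aut G = Iso G G

IsoClosed : (Digraph → Set) → Set₁
IsoClosed C = ∀ G H → Iso G H → C G → C H

IsSHom : (G H : Digraph) → (V G → V H) → Set
IsSHom G H f = (∀ x y → Arc G x y → Arc H (f x) (f y))
             × (∀ x y → x ≢ y → Arc G x y → f x ≢ f y)

SHom : Digraph → Digraph → Set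
SHom G H = Σ (V G → V H) (IsSHom G H)

compSH : {G H K : Digraph} → SHom H K → SHom G H → SHom G K
compSH (g , ga , gp) (f , fa , fp) =
  (λ x → g (f x)) ,
  (λ x y a → ga _ _ (fa x y a)) ,
  (λ x y ne a → gp _ _ (fp x y ne a) (fa x y a))

isoSH : {G H : Digraph} → Iso G H → SHom G H
isoSH {G} {H} (f , e) =
  Inverse.to f ,
  (λ x y a → Equivalence.to (e x y) a) ,
  (λ x y ne _ eq → ne (inj x y eq))
  where
  inj : ∀ x y → Inverse.to f x ≡ Inverse.to f y → x ≡ y
  inj x y eq = trans (sym (Inverse.strictlyInverseʳ f x))
                 (trans (cong (Inverse.from f) eq) (Inverse.strictlyInverseʳ f y))

data Setting : Set₁ where
  set-i   : Setting
  -- 𝔗_a ⊆ 𝔇' ⊆ 𝔇 ; since 𝔇 is a representative system, 𝔇' is an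
  -- isomorphism-closed class of finite digraphs here
  set-ii  : (C : Digraph → Set)
          → (∀ G → C G → Finite G)
          → (∀ G → Finite G → NoClosedWalk* G → C G)
          → IsoClosed C
          → Setting
  set-iii : Setting
  set-iv  : Setting

𝔇' : Setting → Digraph → Set
𝔇' set-i G = Finite G
𝔇' (set-ii C _ _ _) G = C G
𝔇' set-iii G = Finite G × IsPoset G
𝔇' set-iv G = Finite G × IsStrictPoset G

RCond : Setting → Digraph → Set
RCond set-i R = ⊤
RCond (set-ii _ _ _ _) R = NoClosedWalk* R
RCond set-iii R = IsPoset R
RCond set-iv R = IsStrictPoset R

SScheme : Setting → Digraph → Digraph → Set₁
SScheme s R S = (G : Digraph) → 𝔇' s G → SHom G R → SHom G S

Triple : Digraph → Set₁
Triple T = V T × (V T → Set) × (V T → Set)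

_≈₃_ : {T : Digraph} → Triple T → Triple T → Set
(x , A , B) ≈₃ (y , A' , B') = x ≡ y × (∀ z → A z ⇔ A' z) × (∀ z → B z ⇔ B' z)

syntax ≈₃-syn T a b = a ≈₃[ T ] b
≈₃-syn : (T : Digraph) → Triple T → Triple T → Set
≈₃-syn T a b = _≈₃_ {T} a b

Img : {A B : Set} → (A → B) → (A → Set) → B → Set
Img f P y = Σ _ λ x → P x × f x ≡ y

Nin : (G : Digraph) → V G → V G → Set
Nin G v w = w ≢ v × Arc G w v

Nout : (G : Digraph) → V G → V G → Set
Nout G v w = w ≢ v × Arc G v w

α : (T G : Digraph) → (V G → V T) → V G → Triple T
α T G ξ v = ξ v , Img ξ (Nin G v) , Img ξ (Nout G v)

allᵇ : {A : Set} → (A → Bool) → List A → Bool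
allᵇ p [] = true
allᵇ p (x ∷ xs) = p x ∧ allᵇ p xs

module _ (R : FinGraph) where
  private r = size R

  neqᵇ : Fin r → Fin r → Bool
  neqᵇ w v = not (does (w ≟ v))

  -- D ⊆ N^in_R(v) and U ⊆ N^out_R(v), decided
  validᵇ : Fin r → Subset r → Subset r → Bool
  validᵇ v D U = allᵇ (λ w → (not (lookup D w) ∨ (neqᵇ w v ∧ arc R w v))
                          ∧ (not (lookup U w) ∨ (neqᵇ w v ∧ arc R v w)))
                     (allFin r)

  EVo : Set
  EVo = Σ (Fin r × Subset r × Subset r) λ t →
          T (validᵇ (proj₁ t) (proj₁ (proj₂ t)) (proj₂ (proj₂ t)))

  𝔞₁ : EVo → Fin r
  𝔞₁ ((v , _ , _) , _) = v
  𝔞₂ : EVo → Subset r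
  𝔞₂ ((_ , D , _) , _) = D
  𝔞₃ : EVo → Subset r
  𝔞₃ ((_ , _ , U) , _) = U

  asTriple : EVo → Triple ⟦ R ⟧
  asTriple 𝔞 = 𝔞₁ 𝔞 , (λ w → w ∈ₛ 𝔞₂ 𝔞) , (λ w → w ∈ₛ 𝔞₃ 𝔞)

-- G ranges over the digraphs in 𝔇' on some Fin n
-- (with Boolean arcs): every finite digraph is isomorphic to one of
-- these, and 𝔇' is isomorphism-closed, so this is the paper's
-- definition with such digraphs as the representative system.
ℰ : Setting → FinGraph → Digraph
ℰ s R = record
  { V   = EVo R
  ; Arc = λ 𝔞 𝔟 → Σ FinGraph λ G → 𝔇' s ⟦ G ⟧ × Σ (SHom ⟦ G ⟧ ⟦ R ⟧) λ ξ →
            Σ (Fin (size G)) λ v → Σ (Fin (size G)) λ w →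
              T (arc G v w)
              × α ⟦ R ⟧ ⟦ G ⟧ (proj₁ ξ) v ≈₃[ ⟦ R ⟧ ] asTriple R 𝔞
              × α ⟦ R ⟧ ⟦ G ⟧ (proj₁ ξ) w ≈₃[ ⟦ R ⟧ ] asTriple R 𝔟
  }

φ : (s : Setting) (R : FinGraph) → V (ℰ s R) → Fin (size R)
φ s R = 𝔞₁ R

-- The digraphs X(𝔞):  vertex set  D ⊎ {p} ⊎ U

XV : ℕ → ℕ → Set
XV m n = Fin m ⊎ (⊤ ⊎ Fin n)

pt : {m n : ℕ} → XV m n
pt = inj₂ (inj₁ tt)

data XArc (m n : ℕ) : XV m n → XV m n → Set where
  dp : (d : Fin m) → XArc m n (inj₁ d) pt
  pu : (u : Fin n) → XArc m n pt (inj₂ (inj₂ u))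

data XArcT (m n : ℕ) : XV m n → XV m n → Set where
  dp : (d : Fin m) → XArcT m n (inj₁ d) pt
  pu : (u : Fin n) → XArcT m n pt (inj₂ (inj₂ u))
  du : (d : Fin m) (u : Fin n) → XArcT m n (inj₁ d) (inj₂ (inj₂ u))

XArcS : Setting → (m n : ℕ) → XV m n → XV m n → Set
XArcS set-i m n x y = XArc m n x y
XArcS (set-ii _ _ _ _) m n x y = XArc m n x y
XArcS set-iii m n x y = XArcT m n x y ⊎ x ≡ y
XArcS set-iv m n x y = XArcT m n x y

X : Setting → (R : FinGraph) → EVo R → Digraph
X s R 𝔞 = record { V = XV ∣ 𝔞₂ R 𝔞 ∣ ∣ 𝔞₃ R 𝔞 ∣
                 ; Arc = XArcS s ∣ 𝔞₂ R 𝔞 ∣ ∣ 𝔞₃ R 𝔞 ∣ }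

IsIota : (s : Setting) (R : FinGraph) (𝔞 : EVo R) → (V (X s R 𝔞) → Fin (size R)) → Set
IsIota s R 𝔞 ι =
    ι pt ≡ 𝔞₁ R 𝔞
  × (∀ d d' → ι (inj₁ d) ≡ ι (inj₁ d') → d ≡ d')
  × (∀ y → (Σ _ λ d → ι (inj₁ d) ≡ y) ⇔ y ∈ₛ 𝔞₂ R 𝔞)
  × (∀ u u' → ι (inj₂ (inj₂ u)) ≡ ι (inj₂ (inj₂ u')) → u ≡ u')
  × (∀ y → (Σ _ λ u → ι (inj₂ (inj₂ u)) ≡ y) ⇔ y ∈ₛ 𝔞₃ R 𝔞)

{-# OPTIONS --safe #-}
module Submission where

-- Since π is an automorphism, α^R_{X(𝔞),ι∘π}(v) = α^R_{X(𝔞),ι}(π v), so the locality hypothesis on ρ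
-- gives the first claim. An automorphism of X(𝔞) fixes p, and α^R_{X(𝔞),ι}(p) = 𝔞 by the defining
-- properties of ι; moreover α^R_{ℰ(R),φ_R}(𝔞) = 𝔞, because 𝔞 occurs as the α-triple of p in X(𝔞),
-- whose in- and out-neighbours of p are exactly D and U. The locality hypothesis applied at p and
-- at 𝔞 thus gives α^S_{X(𝔞),ρ(ι∘π)}(p) = ε(𝔞), and its three components are the images of p, of
-- D = N^in(p) and of U = N^out(p).

open import Defs
open import Data.Bool using (Bool; true; false; T; not; _∧_; _∨_)
open import Data.Bool.Properties using (T-∧; T-≡; T?)
open import Data.Empty using (⊥-elim)
open import Data.Fin using (Fin; zero; suc; _≟_)
open import Data.Fin.Properties using (+↔⊎; any?)
open import Data.Fin.Subset using (Subset) renaming (_∈_ to _∈ₛ_)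
open import Data.List using ([]; _∷_; map; allFin)
open import Data.List.Membership.Propositional using (_∈_)
open import Data.List.Membership.Propositional.Properties using (∈-map⁺)
open import Data.Nat using (ℕ; suc; _+_)
open import Data.Product using (Σ; _×_; _,_; proj₁; proj₂)
open import Data.Product.Function.NonDependent.Propositional using (_×-⇔_)
open import Data.Sum using (_⊎_; inj₁; inj₂)
open import Data.Sum.Function.Propositional using (_⊎-↔_)
open import Data.Sum.Properties using (≡-dec)
open import Data.Unit using (⊤; tt)
import Data.Unit.Properties as ⊤
open import Data.Vec using (lookup; tabulate)
open import Data.Vec.Properties using (lookup∘tabulate; []=⇒lookup; lookup⇒[]=)
open import Function using (_∘_)
open import Function.Bundles using (_↔_; _⇔_; Inverse; Equivalence; Injection; mk⇔; mk↔ₛ′)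
open import Function.Properties.Equivalence using (⇔-isEquivalence)
open import Function.Properties.Inverse using (↔-refl; ↔-sym; ↔-trans; Inverse⇒Injection)
open import Level using (0ℓ)
open import Relation.Binary.Structures using (IsEquivalence)
open import Relation.Nullary using (¬_; Dec; yes; no)
open import Relation.Nullary.Decidable using (isYes; toWitness; fromWitness; _×-dec_; _⊎-dec_; ¬?)
open import Relation.Binary.PropositionalEquality using (_≡_; _≢_; refl; sym; trans; cong; subst; subst₂)

private module ⇔ = IsEquivalence (⇔-isEquivalence {0ℓ})

≈₃-sym : {T : Digraph} {a b : Triple T} → a ≈₃[ T ] b → b ≈₃[ T ] a
≈₃-sym (x≡y , A⇔A′ , B⇔B′) = sym x≡y , (λ z → ⇔.sym (A⇔A′ z)) , (λ z → ⇔.sym (B⇔B′ z))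

≈₃-trans : {T : Digraph} {a b c : Triple T} → a ≈₃[ T ] b → b ≈₃[ T ] c → a ≈₃[ T ] c
≈₃-trans (x≡y , A⇔A′ , B⇔B′) (y≡z , A′⇔A″ , B′⇔B″) =
  trans x≡y y≡z , (λ z → ⇔.trans (A⇔A′ z) (A′⇔A″ z)) , (λ z → ⇔.trans (B⇔B′ z) (B′⇔B″ z))

Img-↔ : {A B C : Set} (e : A ↔ B) {P : A → Set} {Q : B → Set} {h : B → C} →
        (∀ a → P a ⇔ Q (Inverse.to e a)) → ∀ z → Img (h ∘ Inverse.to e) P z ⇔ Img h Q z
Img-↔ e {Q = Q} {h} P⇔Q z = mk⇔
  (λ (a , Pa , ha≡z) → to a , Equivalence.to (P⇔Q a) Pa , ha≡z)
  (λ (b , Qb , hb≡z) → from b , Equivalence.from (P⇔Q (from b)) (subst Q (sym (to-from b)) Qb)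
                              , trans (cong h (to-from b)) hb≡z)
  where open Inverse e renaming (strictlyInverseˡ to to-from)

module _ {G H : Digraph} (f : Iso G H) where
  private
    to : V G → V H
    to = Inverse.to (proj₁ f)
    from : V H → V G
    from = Inverse.from (proj₁ f)
    to-from : ∀ y → to (from y) ≡ y
    to-from = Inverse.strictlyInverseˡ (proj₁ f)

  Iso-sym : Iso H G
  Iso-sym = ↔-sym (proj₁ f) , λ x y →
    ⇔.sym (subst₂ (λ x′ y′ → Arc G (from x) (from y) ⇔ Arc H x′ y′) (to-from x) (to-from y)
                  (proj₂ f (from x) (from y)))

  Iso-≢ : ∀ {x y} → (x ≢ y) ⇔ (to x ≢ to y)
  Iso-≢ = mk⇔ (λ x≢y → x≢y ∘ Injection.injective (Inverse⇒Injection (proj₁ f))) (λ tx≢ty → tx≢ty ∘ cong to)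

  α-Iso : (T : Digraph) (ξ : V H → V T) (x : V G) → α T G (ξ ∘ to) x ≈₃[ T ] α T H ξ (to x)
  α-Iso T ξ x = refl , Img-↔ (proj₁ f) (λ y → Iso-≢ ×-⇔ proj₂ f y x)
                    , Img-↔ (proj₁ f) (λ y → Iso-≢ ×-⇔ proj₂ f x y)

  Finite-Iso : Finite G → Finite H
  Finite-Iso (xs , xs-complete) =
    map to xs , λ y → subst (_∈ map to xs) (to-from y) (∈-map⁺ to (xs-complete (from y)))

  private
    arc⁻ : ∀ {x y} → Arc H x y → Arc G (from x) (from y)
    arc⁻ = Equivalence.to (proj₂ Iso-sym _ _)
    arc⁺ : ∀ {x y} → Arc G (from x) (from y) → Arc H x y
    arc⁺ = Equivalence.from (proj₂ Iso-sym _ _)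
    from-injective : ∀ {x y} → from x ≡ from y → x ≡ y
    from-injective {x} {y} fx≡fy = trans (sym (to-from x)) (trans (cong to fx≡fy) (to-from y))

  IsPoset-Iso : IsPoset G → IsPoset H
  IsPoset-Iso (reflexive , antisymmetric , transitive) =
    (λ x → arc⁺ (reflexive (from x))) ,
    (λ x y xy yx → from-injective (antisymmetric _ _ (arc⁻ xy) (arc⁻ yx))) ,
    (λ x y z xy yz → arc⁺ (transitive _ _ _ (arc⁻ xy) (arc⁻ yz)))

  IsStrictPoset-Iso : IsStrictPoset G → IsStrictPoset H
  IsStrictPoset-Iso (irreflexive , transitive) =
    (λ x xx → irreflexive (from x) (arc⁻ xx)) ,
    (λ x y z xy yz → arc⁺ (transitive _ _ _ (arc⁻ xy) (arc⁻ yz)))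

𝔇'-Iso : (s : Setting) → IsoClosed (𝔇' s)
𝔇'-Iso set-i G H f = Finite-Iso {G} {H} f
𝔇'-Iso (set-ii _ _ _ closed) = closed
𝔇'-Iso set-iii G H f (finite , poset) = Finite-Iso {G} {H} f finite , IsPoset-Iso {G} {H} f poset
𝔇'-Iso set-iv G H f (finite , poset) = Finite-Iso {G} {H} f finite , IsStrictPoset-Iso {G} {H} f poset

module _ (G : Digraph) {k : ℕ} (e : Fin k ↔ V G) (Arc? : ∀ x y → Dec (Arc G x y)) where
  finGraph : FinGraph
  finGraph = record { size = k ; arc = λ i j → isYes (Arc? (Inverse.to e i) (Inverse.to e j)) }

  finGraph-Iso : Iso ⟦ finGraph ⟧ G
  finGraph-Iso = e , λ i j → mk⇔ toWitness fromWitness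

module _ {m n : ℕ} where
  Xᵐₙ : Setting → Digraph
  Xᵐₙ s = record { V = XV m n ; Arc = XArcS s m n }

  XArc⊆XArcT : ∀ {x y} → XArc m n x y → XArcT m n x y
  XArc⊆XArcT (dp d) = dp d
  XArc⊆XArcT (pu u) = pu u

  XArc⊆XArcS : ∀ s {x y} → XArc m n x y → XArcS s m n x y
  XArc⊆XArcS set-i xy = xy
  XArc⊆XArcS (set-ii _ _ _ _) xy = xy
  XArc⊆XArcS set-iii xy = inj₁ (XArc⊆XArcT xy)
  XArc⊆XArcS set-iv xy = XArc⊆XArcT xy

  XArcS⊆XArcT⊎≡ : ∀ s {x y} → XArcS s m n x y → XArcT m n x y ⊎ x ≡ y
  XArcS⊆XArcT⊎≡ set-i xy = inj₁ (XArc⊆XArcT xy)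
  XArcS⊆XArcT⊎≡ (set-ii _ _ _ _) xy = inj₁ (XArc⊆XArcT xy)
  XArcS⊆XArcT⊎≡ set-iii xy = xy
  XArcS⊆XArcT⊎≡ set-iv xy = inj₁ xy

  module _ (s : Setting) where
    ¬XArcS-into-D : ∀ {x d} → x ≢ inj₁ d → ¬ XArcS s m n x (inj₁ d)
    ¬XArcS-into-D x≢d xd with XArcS⊆XArcT⊎≡ s xd
    ... | inj₁ ()
    ... | inj₂ x≡d = x≢d x≡d

    ¬XArcS-from-U : ∀ {x u} → x ≢ inj₂ (inj₂ u) → ¬ XArcS s m n (inj₂ (inj₂ u)) x
    ¬XArcS-from-U x≢u ux with XArcS⊆XArcT⊎≡ s ux
    ... | inj₁ ()
    ... | inj₂ u≡x = x≢u (sym u≡x)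

    XArcS-into-p : ∀ {x} → x ≢ pt → XArcS s m n x pt → Σ (Fin m) λ d → x ≡ inj₁ d
    XArcS-into-p x≢p xp with XArcS⊆XArcT⊎≡ s xp
    ... | inj₁ (dp d) = d , refl
    ... | inj₂ x≡p = ⊥-elim (x≢p x≡p)

    XArcS-from-p : ∀ {x} → x ≢ pt → XArcS s m n pt x → Σ (Fin n) λ u → x ≡ inj₂ (inj₂ u)
    XArcS-from-p x≢p px with XArcS⊆XArcT⊎≡ s px
    ... | inj₁ (pu u) = u , refl
    ... | inj₂ p≡x = ⊥-elim (x≢p (sym p≡x))

    Img-Nin-p : {B : Set} (h : XV m n → B) (y : B) →
                Img h (Nin (Xᵐₙ s) pt) y ⇔ (Σ (Fin m) λ d → h (inj₁ d) ≡ y)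
    Img-Nin-p h y = mk⇔ into-p (λ (d , hd≡y) → inj₁ d , ((λ ()) , XArc⊆XArcS s (dp d)) , hd≡y)
      where
      into-p : Img h (Nin (Xᵐₙ s) pt) y → Σ (Fin m) λ d → h (inj₁ d) ≡ y
      into-p (x , (x≢p , xp) , hx≡y) with XArcS-into-p x≢p xp
      ... | d , refl = d , hx≡y

    Img-Nout-p : {B : Set} (h : XV m n → B) (y : B) →
                 Img h (Nout (Xᵐₙ s) pt) y ⇔ (Σ (Fin n) λ u → h (inj₂ (inj₂ u)) ≡ y)
    Img-Nout-p h y = mk⇔ from-p (λ (u , hu≡y) → inj₂ (inj₂ u) , ((λ ()) , XArc⊆XArcS s (pu u)) , hu≡y)
      where
      from-p : Img h (Nout (Xᵐₙ s) pt) y → Σ (Fin n) λ u → h (inj₂ (inj₂ u)) ≡ y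
      from-p (x , (x≢p , px) , hx≡y) with XArcS-from-p x≢p px
      ... | u , refl = u , hx≡y

    module _ (π : Aut (Xᵐₙ s)) where
      private
        πᵥ : XV m n → XV m n
        πᵥ = Inverse.to (proj₁ π)
        π-arc : ∀ {x y} → XArcS s m n x y → XArcS s m n (πᵥ x) (πᵥ y)
        π-arc = Equivalence.to (proj₂ π _ _)
        π-≢ : ∀ x y → x ≢ y → πᵥ x ≢ πᵥ y
        π-≢ x y = Equivalence.to (Iso-≢ {Xᵐₙ s} {Xᵐₙ s} π {x} {y})

      -- If π moved p into D (resp. U), the arc d → p (resp. p → u) would be sent to a proper arc
      -- ending in D (resp. starting in U).
      Aut-fixes-p : πᵥ pt ≡ pt
      Aut-fixes-p with πᵥ pt in πp≡
      ... | inj₂ (inj₁ tt) = refl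
      ... | inj₁ d = ⊥-elim (¬XArcS-into-D
              (λ πd≡d → π-≢ (inj₁ d) pt (λ ()) (trans πd≡d (sym πp≡)))
              (subst (XArcS s m n (πᵥ (inj₁ d))) πp≡ (π-arc (XArc⊆XArcS s (dp d)))))
      ... | inj₂ (inj₂ u) = ⊥-elim (¬XArcS-from-U
              (λ πu≡u → π-≢ pt (inj₂ (inj₂ u)) (λ ()) (trans πp≡ (sym πu≡u)))
              (subst (λ x → XArcS s m n x (πᵥ (inj₂ (inj₂ u)))) πp≡ (π-arc (XArc⊆XArcS s (pu u)))))

  XArc? : ∀ x y → Dec (XArc m n x y)
  XArc? (inj₁ d) (inj₂ (inj₁ tt)) = yes (dp d)
  XArc? (inj₂ (inj₁ tt)) (inj₂ (inj₂ u)) = yes (pu u)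
  XArc? (inj₁ _) (inj₁ _) = no λ ()
  XArc? (inj₁ _) (inj₂ (inj₂ _)) = no λ ()
  XArc? (inj₂ (inj₁ tt)) (inj₁ _) = no λ ()
  XArc? (inj₂ (inj₁ tt)) (inj₂ (inj₁ tt)) = no λ ()
  XArc? (inj₂ (inj₂ _)) _ = no λ ()

  XArcT? : ∀ x y → Dec (XArcT m n x y)
  XArcT? (inj₁ d) (inj₂ (inj₁ tt)) = yes (dp d)
  XArcT? (inj₁ d) (inj₂ (inj₂ u)) = yes (du d u)
  XArcT? (inj₂ (inj₁ tt)) (inj₂ (inj₂ u)) = yes (pu u)
  XArcT? (inj₁ _) (inj₁ _) = no λ ()
  XArcT? (inj₂ (inj₁ tt)) (inj₁ _) = no λ ()
  XArcT? (inj₂ (inj₁ tt)) (inj₂ (inj₁ tt)) = no λ ()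
  XArcT? (inj₂ (inj₂ _)) _ = no λ ()

  XArcS? : ∀ s x y → Dec (XArcS s m n x y)
  XArcS? set-i = XArc?
  XArcS? (set-ii _ _ _ _) = XArc?
  XArcS? set-iii x y = XArcT? x y ⊎-dec ≡-dec _≟_ (≡-dec ⊤._≟_ _≟_) x y
  XArcS? set-iv = XArcT?

  Fin↔XV : Fin (m + suc n) ↔ XV m n
  Fin↔XV = ↔-trans +↔⊎ (↔-refl ⊎-↔ Fin-suc↔⊤⊎)
    where
    Fin-suc↔⊤⊎ : Fin (suc n) ↔ (⊤ ⊎ Fin n)
    Fin-suc↔⊤⊎ = mk↔ₛ′ (λ { zero → inj₁ tt ; (suc i) → inj₂ i })
                       (λ { (inj₁ tt) → zero ; (inj₂ i) → suc i })
                       (λ { (inj₁ tt) → refl ; (inj₂ i) → refl })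
                       (λ { zero → refl ; (suc i) → refl })

toSubset : {r : ℕ} {P : Fin r → Set} → (∀ y → Dec (P y)) → Subset r
toSubset P? = tabulate (isYes ∘ P?)

∈-toSubset : {r : ℕ} {P : Fin r → Set} (P? : ∀ y → Dec (P y)) (y : Fin r) → y ∈ₛ toSubset P? ⇔ P y
∈-toSubset P? y = mk⇔
  (λ y∈ → toWitness (Equivalence.from T-≡ (trans (sym (lookup∘tabulate _ y)) ([]=⇒lookup y∈))))
  (λ Py → lookup⇒[]= y _ (trans (lookup∘tabulate _ y) (Equivalence.to T-≡ (fromWitness Py))))

allᵇ-intro : {A : Set} {p : A → Bool} → (∀ x → T (p x)) → ∀ xs → T (allᵇ p xs)
allᵇ-intro all-p [] = tt
allᵇ-intro all-p (x ∷ xs) = Equivalence.from T-∧ (all-p x , allᵇ-intro all-p xs)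

T-not-∨ : ∀ {b c} → (T b → T c) → T (not b ∨ c)
T-not-∨ {false} _ = tt
T-not-∨ {true} b⇒c = b⇒c tt

module _ (R : FinGraph) where
  private r = size R

  T-neqᵇ : ∀ {w v} → w ≢ v → T (neqᵇ R w v)
  T-neqᵇ {w} {v} w≢v with w ≟ v
  ... | yes w≡v = w≢v w≡v
  ... | no _ = tt

  validᵇ-intro : ∀ {v D U} → (∀ w → w ∈ₛ D → w ≢ v × T (arc R w v))
                           → (∀ w → w ∈ₛ U → w ≢ v × T (arc R v w)) → T (validᵇ R v D U)
  validᵇ-intro {v} {D} {U} D⊆ U⊆ =
    allᵇ-intro (λ w → Equivalence.from T-∧ (neighbour D (λ w → arc R w v) D⊆ w , neighbour U (arc R v) U⊆ w))
               (allFin r)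
    where
    neighbour : (A : Subset r) (b : Fin r → Bool) → (∀ w → w ∈ₛ A → w ≢ v × T (b w)) →
                ∀ w → T (not (lookup A w) ∨ (neqᵇ R w v ∧ b w))
    neighbour A b A⊆ w = T-not-∨ λ w∈A →
      let (w≢v , bw) = A⊆ w (lookup⇒[]= w A (Equivalence.to T-≡ w∈A))
      in Equivalence.from T-∧ (T-neqᵇ w≢v , bw)

  α-EVo : (G : FinGraph) (ξ : SHom ⟦ G ⟧ ⟦ R ⟧) (v : Fin (size G)) →
          Σ (EVo R) λ 𝔟 → α ⟦ R ⟧ ⟦ G ⟧ (proj₁ ξ) v ≈₃[ ⟦ R ⟧ ] asTriple R 𝔟
  α-EVo G (ξ , ξ-arc , ξ-strict) v =
    ((ξ v , toSubset Nin? , toSubset Nout?) , validᵇ-intro D⊆ U⊆) ,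
    refl , (λ z → ⇔.sym (∈-toSubset Nin? z)) , (λ z → ⇔.sym (∈-toSubset Nout? z))
    where
    Nin? : ∀ y → Dec (Img ξ (Nin ⟦ G ⟧ v) y)
    Nin? y = any? λ x → (¬? (x ≟ v) ×-dec T? (arc G x v)) ×-dec ξ x ≟ y
    Nout? : ∀ y → Dec (Img ξ (Nout ⟦ G ⟧ v) y)
    Nout? y = any? λ x → (¬? (x ≟ v) ×-dec T? (arc G v x)) ×-dec ξ x ≟ y
    D⊆ : ∀ w → w ∈ₛ toSubset Nin? → w ≢ ξ v × T (arc R w (ξ v))
    D⊆ w w∈ with Equivalence.to (∈-toSubset Nin? w) w∈
    ... | x , (x≢v , xv) , refl = ξ-strict x v x≢v xv , ξ-arc x v xv
    U⊆ : ∀ w → w ∈ₛ toSubset Nout? → w ≢ ξ v × T (arc R (ξ v) w)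
    U⊆ w w∈ with Equivalence.to (∈-toSubset Nout? w) w∈
    ... | x , (x≢v , vx) , refl = (λ ξx≡ξv → ξ-strict v x (x≢v ∘ sym) vx (sym ξx≡ξv)) , ξ-arc v x vx

-- The arcs of ℰ(R) only come from digraphs on some Fin k; an element of ℰ_o(R) that does not occur
-- there is isolated in ℰ(R).
Realised : Setting → (R : FinGraph) → EVo R → Set
Realised s R 𝔞 = Σ FinGraph λ G → 𝔇' s ⟦ G ⟧ × Σ (SHom ⟦ G ⟧ ⟦ R ⟧) λ ξ →
                   Σ (Fin (size G)) λ v → α ⟦ R ⟧ ⟦ G ⟧ (proj₁ ξ) v ≈₃[ ⟦ R ⟧ ] asTriple R 𝔞

realised : (s : Setting) (R : FinGraph) (𝔞 : EVo R)
           (G : Digraph) {k : ℕ} (e : Fin k ↔ V G) (Arc? : ∀ x y → Dec (Arc G x y)) → 𝔇' s G →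
           (ξ : SHom G ⟦ R ⟧) (v : V G) → α ⟦ R ⟧ G (proj₁ ξ) v ≈₃[ ⟦ R ⟧ ] asTriple R 𝔞 → Realised s R 𝔞
realised s R 𝔞 G e Arc? G∈ ξ v αv≈𝔞 =
  F , 𝔇'-Iso s G ⟦ F ⟧ (Iso-sym {⟦ F ⟧} {G} iso) G∈ , compSH {⟦ F ⟧} {G} {⟦ R ⟧} ξ (isoSH {⟦ F ⟧} {G} iso) , from v ,
  ≈₃-trans {⟦ R ⟧} (α-Iso {⟦ F ⟧} {G} iso ⟦ R ⟧ (proj₁ ξ) (from v))
    (subst (λ w → α ⟦ R ⟧ G (proj₁ ξ) w ≈₃[ ⟦ R ⟧ ] asTriple R 𝔞) (sym (to-from v)) αv≈𝔞)
  where
  F : FinGraph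
  F = finGraph G e Arc?
  iso : Iso ⟦ F ⟧ G
  iso = finGraph-Iso G e Arc?
  open Inverse e using (from) renaming (strictlyInverseˡ to to-from)

module _ (s : Setting) (R : FinGraph) (φ-shom : IsSHom (ℰ s R) ⟦ R ⟧ (φ s R)) (𝔞 : EVo R) where
  α-φ : Realised s R 𝔞 → α ⟦ R ⟧ (ℰ s R) (φ s R) 𝔞 ≈₃[ ⟦ R ⟧ ] asTriple R 𝔞
  α-φ (G , G∈ , ξ , v , αv≈𝔞) = refl , (λ z → mk⇔ Nin⊆ (Nin⊇ z)) , (λ z → mk⇔ Nout⊆ (Nout⊇ z))
    where
    Nin⊆ : ∀ {z} → Img (φ s R) (Nin (ℰ s R) 𝔞) z → z ∈ₛ 𝔞₂ R 𝔞
    Nin⊆ (𝔟 , (𝔟≢𝔞 , 𝔟𝔞@(_ , _ , ζ , x , y , xy , αx≈𝔟 , αy≈𝔞)) , refl) =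
      Equivalence.to (proj₁ (proj₂ αy≈𝔞) _) (x , (x≢y , xy) , proj₁ αx≈𝔟)
      where
      x≢y : x ≢ y
      x≢y x≡y = proj₂ φ-shom 𝔟 𝔞 𝔟≢𝔞 𝔟𝔞
                  (trans (sym (proj₁ αx≈𝔟)) (trans (cong (proj₁ ζ) x≡y) (proj₁ αy≈𝔞)))

    Nout⊆ : ∀ {z} → Img (φ s R) (Nout (ℰ s R) 𝔞) z → z ∈ₛ 𝔞₃ R 𝔞
    Nout⊆ (𝔟 , (𝔟≢𝔞 , 𝔞𝔟@(_ , _ , ζ , x , y , xy , αx≈𝔞 , αy≈𝔟)) , refl) =
      Equivalence.to (proj₂ (proj₂ αx≈𝔞) _) (y , (y≢x , xy) , proj₁ αy≈𝔟)
      where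
      y≢x : y ≢ x
      y≢x y≡x = proj₂ φ-shom 𝔞 𝔟 (𝔟≢𝔞 ∘ sym) 𝔞𝔟
                  (trans (sym (proj₁ αx≈𝔞)) (trans (cong (proj₁ ζ) (sym y≡x)) (proj₁ αy≈𝔟)))

    Nin⊇ : ∀ z → z ∈ₛ 𝔞₂ R 𝔞 → Img (φ s R) (Nin (ℰ s R) 𝔞) z
    Nin⊇ z z∈ with Equivalence.from (proj₁ (proj₂ αv≈𝔞) z) z∈
    ... | u , (u≢v , uv) , ξu≡z with α-EVo R G ξ u
    ... | 𝔟 , αu≈𝔟 =
      𝔟 , (𝔟≢𝔞 , (G , G∈ , ξ , u , v , uv , αu≈𝔟 , αv≈𝔞)) , trans (sym (proj₁ αu≈𝔟)) ξu≡z
      where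
      𝔟≢𝔞 : 𝔟 ≢ 𝔞
      𝔟≢𝔞 𝔟≡𝔞 = proj₂ (proj₂ ξ) u v u≢v uv
                  (trans (proj₁ αu≈𝔟) (trans (cong (𝔞₁ R) 𝔟≡𝔞) (sym (proj₁ αv≈𝔞))))

    Nout⊇ : ∀ z → z ∈ₛ 𝔞₃ R 𝔞 → Img (φ s R) (Nout (ℰ s R) 𝔞) z
    Nout⊇ z z∈ with Equivalence.from (proj₂ (proj₂ αv≈𝔞) z) z∈
    ... | u , (u≢v , vu) , ξu≡z with α-EVo R G ξ u
    ... | 𝔟 , αu≈𝔟 =
      𝔟 , (𝔟≢𝔞 , (G , G∈ , ξ , v , u , vu , αv≈𝔞 , αu≈𝔟)) , trans (sym (proj₁ αu≈𝔟)) ξu≡z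
      where
      𝔟≢𝔞 : 𝔟 ≢ 𝔞
      𝔟≢𝔞 𝔟≡𝔞 = proj₂ (proj₂ ξ) v u (u≢v ∘ sym) vu
                  (trans (proj₁ αv≈𝔞) (trans (cong (𝔞₁ R) (sym 𝔟≡𝔞)) (sym (proj₁ αu≈𝔟))))

α-ι-p : (s : Setting) (R : FinGraph) (𝔞 : EVo R) (ι : V (X s R 𝔞) → Fin (size R)) → IsIota s R 𝔞 ι →
        α ⟦ R ⟧ (X s R 𝔞) ι pt ≈₃[ ⟦ R ⟧ ] asTriple R 𝔞
α-ι-p s R 𝔞 ι (ιp≡𝔞₁ , _ , ι[D]≡𝔞₂ , _ , ι[U]≡𝔞₃) =
  ιp≡𝔞₁ , (λ z → ⇔.trans (Img-Nin-p s ι z) (ι[D]≡𝔞₂ z))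
        , (λ z → ⇔.trans (Img-Nout-p s ι z) (ι[U]≡𝔞₃ z))

corollary2 :
    (s : Setting) (R : FinGraph) → RCond s ⟦ R ⟧ →
    (S : Digraph) → Finite S →
    (ρ : SScheme s ⟦ R ⟧ S) →
    (∀ (G H : Digraph) (gG : 𝔇' s G) (hH : 𝔇' s H)
       (ξ : SHom G ⟦ R ⟧) (ζ : SHom H ⟦ R ⟧) (v : V G) (w : V H) →
       α ⟦ R ⟧ G (proj₁ ξ) v ≈₃[ ⟦ R ⟧ ] α ⟦ R ⟧ H (proj₁ ζ) w →
       α S G (proj₁ (ρ G gG ξ)) v ≈₃[ S ] α S H (proj₁ (ρ H hH ζ)) w) →
    -- ℰ(R) ∈ 𝔇' and φ_R ∈ 𝒮(ℰ(R),R)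
    (eR : 𝔇' s (ℰ s R)) (φhom : IsSHom (ℰ s R) ⟦ R ⟧ (φ s R)) →
    (𝔞 : EVo R) →
    -- X(𝔞) ∈ 𝔇'; ι(𝔞) a strict homomorphism with the stated properties
    (xa : 𝔇' s (X s R 𝔞)) (ι : SHom (X s R 𝔞) ⟦ R ⟧) → IsIota s R 𝔞 (proj₁ ι) →
    (π : Aut (X s R 𝔞)) →
    let ε = α S (ℰ s R) (proj₁ (ρ (ℰ s R) eR (φ s R , φhom)))
        f = proj₁ (ρ (X s R 𝔞) xa (compSH {X s R 𝔞} {X s R 𝔞} {⟦ R ⟧} ι (isoSH {X s R 𝔞} {X s R 𝔞} π)))
        g = proj₁ (ρ (X s R 𝔞) xa ι)
    in (∀ v → f v ≡ g (Inverse.to (proj₁ π) v))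
       × f pt ≡ proj₁ (ε 𝔞)
       × (∀ y → (Σ _ λ d → f (inj₁ d) ≡ y) ⇔ proj₁ (proj₂ (ε 𝔞)) y)
       × (∀ y → (Σ _ λ u → f (inj₂ (inj₂ u)) ≡ y) ⇔ proj₂ (proj₂ (ε 𝔞)) y)
corollary2 s R _ S _ ρ ρ-local eR φhom 𝔞 xa ι ι-iota π =
  (λ v → proj₁ (ρ-local X𝔞 X𝔞 xa xa ιπ ι v _ (α-Iso {X𝔞} {X𝔞} π ⟦ R ⟧ (proj₁ ι) v))) ,
  proj₁ ριπ-at-p ,
  (λ y → ⇔.trans (⇔.sym (Img-Nin-p s ριπ y)) (proj₁ (proj₂ ριπ-at-p) y)) ,
  (λ y → ⇔.trans (⇔.sym (Img-Nout-p s ριπ y)) (proj₂ (proj₂ ριπ-at-p) y))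
  where
  X𝔞 : Digraph
  X𝔞 = X s R 𝔞
  ιπ : SHom X𝔞 ⟦ R ⟧
  ιπ = compSH {X𝔞} {X𝔞} {⟦ R ⟧} ι (isoSH {X𝔞} {X𝔞} π)
  ριπ : V X𝔞 → V S
  ριπ = proj₁ (ρ X𝔞 xa ιπ)
  ι-at-p : α ⟦ R ⟧ X𝔞 (proj₁ ι) pt ≈₃[ ⟦ R ⟧ ] asTriple R 𝔞
  ι-at-p = α-ι-p s R 𝔞 (proj₁ ι) ι-iota
  𝔞-realised : Realised s R 𝔞
  𝔞-realised = realised s R 𝔞 X𝔞 Fin↔XV (XArcS? s) xa ι pt ι-at-p
  ιπ-at-p : α ⟦ R ⟧ X𝔞 (proj₁ ιπ) pt ≈₃[ ⟦ R ⟧ ] α ⟦ R ⟧ (ℰ s R) (φ s R) 𝔞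
  ιπ-at-p = ≈₃-trans {⟦ R ⟧} (α-Iso {X𝔞} {X𝔞} π ⟦ R ⟧ (proj₁ ι) pt)
    (subst (λ x → α ⟦ R ⟧ X𝔞 (proj₁ ι) x ≈₃[ ⟦ R ⟧ ] α ⟦ R ⟧ (ℰ s R) (φ s R) 𝔞)
           (sym (Aut-fixes-p s π))
           (≈₃-trans {⟦ R ⟧} ι-at-p (≈₃-sym {⟦ R ⟧} (α-φ s R φhom 𝔞 𝔞-realised))))
  ριπ-at-p : α S X𝔞 ριπ pt ≈₃[ S ] α S (ℰ s R) (proj₁ (ρ (ℰ s R) eR (φ s R , φhom))) 𝔞
  ριπ-at-p = ρ-local X𝔞 (ℰ s R) xa eR ιπ (φ s R , φhom) pt 𝔞 ιπ-at-p
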